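{- Let $(A,B)$ be an invertible Jones pair of $n\times n$ matrices with $A$ symmetric, let $d^2=n$, and let \[ V=\begin{pmatrix} dA & -dA & B^{(-)} & B^{(-)}\\ -dA & dA & B^{(-)} & B^{(-)}\\ (B^{(-)})^T & (B^{(-)})^T & dA & -dA\\ (B^{(-)})^T & (B^{(-)})^T & -dA & dA \end{pmatrix}. \] Let $M\in\mathcal B=\{\mathcal M(F,G,H) : F\in\mathcal N_A,\ G,H\in\mathcal N_{A,B}\}$. Then for all $r\in\{1,\dots,2n\}$ and $s\in\{2n+1,\dots,4n\}$, the vector $Ve_r\circ V^{(-)}e_s\in\mathbb C^{4n}$ is an eigenvector of $M$ (here $e_1,\dots,e_{4n}$ is the standard basis of $\mathbb C^{4n}$).
   Context: All matrices are complex. $X\circ Y$ is the Schur product; $X^{(-)}$ is the Schur inverse of a matrix with no zero entries. $W$ ($n\times n$) is type-II if $W(W^{(-)})^T=nI$. For a matrix $C$, $X_C(M)=CM$, $\Delta_C(M)=C\circ M$. A Jones pair is a pair $(A,B)$ of $n\times n$ matrices with $X_A$, $\Delta_B$ invertible, $X_A\Delta_BX_A=\Delta_BX_A\Delta_B$ and $X_A\Delta_{B^T}X_A=\Delta_{B^T}X_A\Delta_{B^T}$; it is invertible if moreover $A$ has no zero entry and $B$ is invertible (equivalently $A,B$ type-II). With $e_1,\dots,e_n$ the standard basis of $\mathbb C^n$, for $P$ invertible and $Q$ without zero entries, $\mathcal N_{P,Q}$ is the set of matrices $M$ such that every $Pe_i\circ Qe_j$ is an eigenvector of $M$, and $\Theta_{P,Q}(M)$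 is the matrix with $M(Pe_i\circ Qe_j)=\Theta_{P,Q}(M)_{ij}(Pe_i\circ Qe_j)$. For type-II $P$, $\mathcal N_P:=\mathcal N_{P,P^{(-)}}$, $\Theta_P:=\Theta_{P,P^{(-)}}$. Standing facts for the definitions: $\mathcal N_{A,B}=\mathcal N_{A,B^T}$ is closed under transposition and $\mathcal N_A=\mathcal N_{B^{(-)}}$. Pairing: for $H\in\mathcal N_{A,B}$, the matrix paired with $H$ is the unique $K$ with $K^T\in\mathcal N_{A,B^T}$ and $\Theta_{A,B}(H)=\Theta_{A,B^T}(K^T)^T$. For $F\in\mathcal N_A$, $G,H\in\mathcal N_{A,B}$, with $K$ paired with $H$, \[ \mathcal M(F,G,H)=\begin{pmatrix} \Theta_A(F)+H & \Theta_A(F)-H & \Theta_{A,B}(G) & \Theta_{A,B}(G)\\ \Theta_A(F)-H & \Theta_A(F)+H & \Theta_{A,B}(G) & \Theta_{A,B}(G)\\ \Theta_{A,B}(G^T)^T & \Theta_{A,B}(G^T)^T & \Theta_{B^{(-)}}(F)+K & \Theta_{B^{(-)}}(F)-K\\ \Theta_{A,B}(G^T)^T & \Theta_{A,B}(G^T)^T & \Theta_{B^{(-)}}(F)-K & \Theta_{B^{(-)}}(F)+K \end{pmatrix}. \] -}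

module Defs where

open import Level using (Level; _⊔_) renaming (suc to lsuc)
open import Data.Nat using (ℕ; zero; suc) renaming (_*_ to _*ℕ_)
open import Data.Fin using (Fin; zero; suc; remQuot)
open import Data.Product using (Σ; _×_; _,_)
open import Data.List using (List; []; _∷_; _++_; [_])
open import Relation.Nullary using (¬_)
open import Relation.Binary using (Rel)
open import Algebra.Structures using (IsCommutativeRing)

-- A field with a total inverse operation (the value at 0 is unconstrained),
-- equality being a setoid equality _≈_.
record Fld c ℓ : Set (lsuc (c ⊔ ℓ)) where
  infix  4 _≈_
  infixl 6 _+_
  infixl 7 _*_
  field
    Carrier  : Set c
    _≈_      : Rel Carrier ℓ
    _+_ _*_  : Carrier → Carrier → Carrier
    -_       : Carrier → Carrier
    0# 1#    : Carrier
    _⁻¹      : Carrier → Carrier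
    isCommutativeRing : IsCommutativeRing _≈_ _+_ _*_ -_ 0# 1#
    ⁻¹-cong  : ∀ {x y} → x ≈ y → (x ⁻¹) ≈ (y ⁻¹)
    inverseʳ : ∀ x → ¬ (x ≈ 0#) → x * (x ⁻¹) ≈ 1#
    0≉1      : ¬ (0# ≈ 1#)

  fromℕ : ℕ → Carrier
  fromℕ zero    = 0#
  fromℕ (suc k) = 1# + fromℕ k

  -- Horner evaluation of the polynomial a₀ + a₁x + … (coefficient list, low degree first)
  eval : List Carrier → Carrier → Carrier
  eval []       x = 0#
  eval (a ∷ as) x = a + x * eval as x

-- Algebraically closed field of characteristic zero (stand-in for ℂ).
record ACF0 c ℓ : Set (lsuc (c ⊔ ℓ)) where
  field
    fld : Fld c ℓ
  open Fld fld
  field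
    char0      : ∀ k → ¬ (fromℕ (suc k) ≈ 0#)
    -- every monic polynomial of degree ≥ 1 has a root
    algClosed  : ∀ (a : Carrier) (as : List Carrier) →
                 Σ Carrier λ x → eval ((a ∷ as) ++ [ 1# ]) x ≈ 0#

module MatrixDefs {c ℓ} (K : ACF0 c ℓ) where
  open ACF0 K using (fld)
  open Fld fld public

  Vect : ℕ → Set c
  Vect n = Fin n → Carrier

  Mat : ℕ → Set c
  Mat n = Fin n → Fin n → Carrier

  _≈ᵥ_ : ∀ {n} → Vect n → Vect n → Set ℓ
  u ≈ᵥ v = ∀ k → u k ≈ v k

  _≈ₘ_ : ∀ {n} → Mat n → Mat n → Set ℓ
  X ≈ₘ Y = ∀ i j → X i j ≈ Y i j

  sumF : ∀ {n} → (Fin n → Carrier) → Carrier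
  sumF {zero}  f = 0#
  sumF {suc n} f = f zero + sumF (λ k → f (suc k))

  _·_ : ∀ {n} → Mat n → Mat n → Mat n
  (X · Y) i j = sumF (λ k → X i k * Y k j)

  _▹_ : ∀ {n} → Mat n → Vect n → Vect n
  (X ▹ v) i = sumF (λ k → X i k * v k)

  _∘ₘ_ : ∀ {n} → Mat n → Mat n → Mat n
  (X ∘ₘ Y) i j = X i j * Y i j

  _∘ᵥ_ : ∀ {n} → Vect n → Vect n → Vect n
  (u ∘ᵥ v) k = u k * v k

  schurInv : ∀ {n} → Mat n → Mat n
  schurInv X i j = (X i j) ⁻¹

  _ᵀ : ∀ {n} → Mat n → Mat n
  (X ᵀ) i j = X j i

  _⊕_ _⊖_ : ∀ {n} → Mat n → Mat n → Mat n
  (X ⊕ Y) i j = X i j + Y i j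
  (X ⊖ Y) i j = X i j + (- Y i j)

  _⋆_ : ∀ {n} → Carrier → Mat n → Mat n
  (a ⋆ X) i j = a * X i j

  negM : ∀ {n} → Mat n → Mat n
  negM X i j = - X i j

  _⋆ᵥ_ : ∀ {n} → Carrier → Vect n → Vect n
  (a ⋆ᵥ v) k = a * v k

  δ : ∀ {n} → Fin n → Fin n → Carrier
  δ zero    zero    = 1#
  δ zero    (suc _) = 0#
  δ (suc _) zero    = 0#
  δ (suc i) (suc j) = δ i j

  Id : ∀ {n} → Mat n
  Id = δ

  col : ∀ {n} → Mat n → Fin n → Vect n
  col P i k = P k i

  NoZeroEntry : ∀ {n} → Mat n → Set ℓ
  NoZeroEntry X = ∀ i j → ¬ (X i j ≈ 0#)

  Symmetric : ∀ {n} → Mat n → Set ℓ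
  Symmetric X = ∀ i j → X i j ≈ X j i

  Invertible : ∀ {n} → Mat n → Set (c ⊔ ℓ)
  Invertible X = Σ (Mat _) λ Y → ((Y · X) ≈ₘ Id) × ((X · Y) ≈ₘ Id)

  TypeII : ∀ {n} → Mat n → Set ℓ
  TypeII {n} W = NoZeroEntry W × ((W · (schurInv W ᵀ)) ≈ₘ (fromℕ n ⋆ Id))

  InvertibleMap : ∀ {n} → (Mat n → Mat n) → Set (c ⊔ ℓ)
  InvertibleMap {n} Φ = Σ (Mat n → Mat n) λ L →
    (∀ M → L (Φ M) ≈ₘ M) × (∀ M → Φ (L M) ≈ₘ M)

  X[_] : ∀ {n} → Mat n → Mat n → Mat n
  X[ C ] M = C · M

  Δ[_] : ∀ {n} → Mat n → Mat n → Mat n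
  Δ[ C ] M = C ∘ₘ M

  IsJonesPair : ∀ {n} → Mat n → Mat n → Set (c ⊔ ℓ)
  IsJonesPair A B =
    InvertibleMap X[ A ] × InvertibleMap Δ[ B ] ×
    (∀ M → X[ A ] (Δ[ B ] (X[ A ] M)) ≈ₘ Δ[ B ] (X[ A ] (Δ[ B ] M))) ×
    (∀ M → X[ A ] (Δ[ B ᵀ ] (X[ A ] M)) ≈ₘ Δ[ B ᵀ ] (X[ A ] (Δ[ B ᵀ ] M)))

  IsInvertibleJonesPair : ∀ {n} → Mat n → Mat n → Set (c ⊔ ℓ)
  IsInvertibleJonesPair A B = IsJonesPair A B × NoZeroEntry A × Invertible B

  IsEigenvector : ∀ {n} → Mat n → Vect n → Set (c ⊔ ℓ)
  IsEigenvector M v = ¬ (∀ k → v k ≈ 0#) × Σ Carrier λ λ₀ → (M ▹ v) ≈ᵥ (λ₀ ⋆ᵥ v)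

  𝒩 : ∀ {n} → Mat n → Mat n → Mat n → Set (c ⊔ ℓ)
  𝒩 P Q M = ∀ i j → IsEigenvector M (col P i ∘ᵥ col Q j)

  IsΘ : ∀ {n} → Mat n → Mat n → Mat n → Mat n → Set ℓ
  IsΘ P Q M T = ∀ i j → (M ▹ (col P i ∘ᵥ col Q j)) ≈ᵥ (T i j ⋆ᵥ (col P i ∘ᵥ col Q j))

  IsPaired : ∀ {n} → Mat n → Mat n → Mat n → Mat n → Set (c ⊔ ℓ)
  IsPaired A B H K = 𝒩 A (B ᵀ) (K ᵀ) × Σ (Mat _) λ TH → Σ (Mat _) λ TK →
    IsΘ A B H TH × IsΘ A (B ᵀ) (K ᵀ) TK × (TH ≈ₘ (TK ᵀ))

  -- 4×4 block matrix; index a ∈ Fin (4 *ℕ n) corresponds to block ⌊a/n⌋, position a mod n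
  block4 : ∀ {n} → (Fin 4 → Fin 4 → Mat n) → Mat (4 *ℕ n)
  block4 {n} X a b with remQuot {4} n a | remQuot {4} n b
  ... | p , i | q , j = X p q i j

  Vblocks : ∀ {n} → Carrier → Mat n → Mat n → Fin 4 → Fin 4 → Mat n
  Vblocks d A B = go
    where
    dA = d ⋆ A
    Bm = schurInv B
    go : Fin 4 → Fin 4 → Mat _
    go zero zero = dA
    go zero (suc zero) = negM dA
    go zero (suc (suc _)) = Bm
    go (suc zero) zero = negM dA
    go (suc zero) (suc zero) = dA
    go (suc zero) (suc (suc _)) = Bm
    go (suc (suc _)) zero = Bm ᵀ
    go (suc (suc _)) (suc zero) = Bm ᵀ
    go (suc (suc zero)) (suc (suc zero)) = dA
    go (suc (suc zero)) (suc (suc (suc _))) = negM dA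
    go (suc (suc (suc _))) (suc (suc zero)) = negM dA
    go (suc (suc (suc _))) (suc (suc (suc _))) = dA

  Vmat : ∀ {n} → Carrier → Mat n → Mat n → Mat (4 *ℕ n)
  Vmat d A B = block4 (Vblocks d A B)

  -- blocks of 𝓜(F,G,H), given ΘAF = Θ_A(F), ΘBF = Θ_{B^(-)}(F), ΘG = Θ_{A,B}(G),
  -- ΘGT = Θ_{A,B}(Gᵀ), H and K paired with H
  Mblocks : ∀ {n} → (ΘAF ΘBF ΘG ΘGT H K : Mat n) → Fin 4 → Fin 4 → Mat n
  Mblocks ΘAF ΘBF ΘG ΘGT H K = go
    where
    go : Fin 4 → Fin 4 → Mat _
    go zero zero = ΘAF ⊕ H
    go zero (suc zero) = ΘAF ⊖ H
    go zero (suc (suc _)) = ΘG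
    go (suc zero) zero = ΘAF ⊖ H
    go (suc zero) (suc zero) = ΘAF ⊕ H
    go (suc zero) (suc (suc _)) = ΘG
    go (suc (suc _)) zero = ΘGT ᵀ
    go (suc (suc _)) (suc zero) = ΘGT ᵀ
    go (suc (suc zero)) (suc (suc zero)) = ΘBF ⊕ K
    go (suc (suc zero)) (suc (suc (suc _))) = ΘBF ⊖ K
    go (suc (suc (suc _))) (suc (suc zero)) = ΘBF ⊖ K
    go (suc (suc (suc _))) (suc (suc (suc _))) = ΘBF ⊕ K

  In𝓑 : ∀ {n} → Mat n → Mat n → Mat (4 *ℕ n) → Set (c ⊔ ℓ)
  In𝓑 {n} A B M =
    Σ (Mat n) λ F → Σ (Mat n) λ G → Σ (Mat n) λ H → Σ (Mat n) λ K →
    Σ (Mat n) λ ΘAF → Σ (Mat n) λ ΘBF → Σ (Mat n) λ ΘG → Σ (Mat n) λ ΘGT →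
      𝒩 A (schurInv A) F × 𝒩 A B G × 𝒩 A B H × IsPaired A B H K ×
      IsΘ A (schurInv A) F ΘAF ×
      IsΘ (schurInv B) (schurInv (schurInv B)) F ΘBF ×
      IsΘ A B G ΘG × IsΘ A B (G ᵀ) ΘGT ×
      (M ≈ₘ block4 (Mblocks ΘAF ΘBF ΘG ΘGT H K))

{-# OPTIONS --safe #-}
-- In block coordinates r = (p , i) with p ∈ {0, 1} and s = (q , j) with q ∈ {2, 3}, the vector
-- v = Ve_r ∘ V⁽⁻⁾e_s has the shape (x, −x, y, −y) with x = ±d (Ae_i ∘ Be_j) and
-- y = ±d⁻¹ (B⁽⁻⁾ᵀe_i ∘ A⁽⁻⁾e_j). Against this sign pattern all blocks of 𝓜(F,G,H) built from F and G
-- cancel and 𝓜v = 2(Hx, −Hx, Ky, −Ky), so it suffices that x and y are eigenvectors of H and K for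
-- the same eigenvalue. For x the eigenvalue is Θ_{A,B}(H)_ij by definition. For y, the Jones pair
-- equations give A(Ae_h ∘ Be_c) = B_hc (Ae_h ∘ Be_c) and the same with Bᵀ; together with B B⁻¹ = I
-- they force the diagonal of A to be constant and each column of B⁻¹ to be proportional to the
-- corresponding column of B⁽⁻⁾ᵀ. Hence y is a multiple of a vector of the basis dual to
-- (Ae_j ∘ Bᵀe_b)_b. Those are eigenvectors of Kᵀ, so the dual basis consists of eigenvectors of K
-- with the same eigenvalues, and Θ_{A,Bᵀ}(Kᵀ)_ji = Θ_{A,B}(H)_ij because K is paired with H.

module Submission where

open import Defs
open import Data.Nat using (ℕ; _<_; _≤_) renaming (_*_ to _*ℕ_)
open import Data.Fin using (Fin; toℕ)

open import Data.Nat using (zero; suc; s≤s)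
import Data.Nat as ℕ
import Data.Nat.Properties as ℕₚ
open import Data.Fin using (zero; suc; _↑ˡ_; _↑ʳ_; combine; quotient; remainder)
open import Data.Fin.Patterns using (0F; 1F; 2F; 3F)
import Data.Fin.Properties as Finₚ
open import Data.Product using (Σ-syntax; _×_; _,_; proj₁; proj₂)
open import Level using (_⊔_)
open import Relation.Nullary using (¬_)
import Relation.Binary.PropositionalEquality as ≡
open import Algebra.Bundles using (CommutativeRing)
open import Algebra.Structures using (IsCommutativeRing)
open import Relation.Binary.Bundles using (Setoid)
import Data.Vec.Functional.Relation.Binary.Equality.Setoid as Pointwise
import Algebra.Properties.CommutativeSemigroup

toℕ-quotient-remainder : ∀ {m} n (r : Fin (m *ℕ n)) →
  toℕ r ≡.≡ n *ℕ toℕ (quotient {m} n r) ℕ.+ toℕ (remainder {m} n r)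
toℕ-quotient-remainder {m} n r =
  ≡.trans (≡.cong toℕ (≡.sym (Finₚ.combine-remQuot {m} n r))) (Finₚ.toℕ-combine (quotient {m} n r) (remainder {m} n r))

quotient-< : ∀ {m} n {k} (r : Fin (m *ℕ n)) → toℕ r < k *ℕ n → toℕ (quotient {m} n r) < k
quotient-< {m} n {k} r r<kn = ℕₚ.*-cancelʳ-< n q k (begin-strict
  q *ℕ n                                   ≡⟨ ℕₚ.*-comm q n ⟩
  n *ℕ q                                   ≤⟨ ℕₚ.m≤m+n (n *ℕ q) _ ⟩
  n *ℕ q ℕ.+ toℕ (remainder {m} n r)       ≡⟨ toℕ-quotient-remainder n r ⟨
  toℕ r                                    <⟨ r<kn ⟩
  k *ℕ n                                   ∎)
  where
  open ℕₚ.≤-Reasoning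
  q : ℕ
  q = toℕ (quotient {m} n r)

quotient-≥ : ∀ {m} n {k} (r : Fin (m *ℕ n)) → k *ℕ n ≤ toℕ r → k ≤ toℕ (quotient {m} n r)
quotient-≥ {m} n {k} r kn≤r = ℕ.s≤s⁻¹ (ℕₚ.*-cancelʳ-< n k (suc q) (begin-strict
  k *ℕ n                                   ≤⟨ kn≤r ⟩
  toℕ r                                    ≡⟨ toℕ-quotient-remainder n r ⟩
  n *ℕ q ℕ.+ toℕ (remainder {m} n r)       <⟨ ℕₚ.+-monoʳ-< (n *ℕ q) (Finₚ.toℕ<n (remainder {m} n r)) ⟩
  n *ℕ q ℕ.+ n                             ≡⟨ ℕₚ.+-comm (n *ℕ q) n ⟩
  n ℕ.+ n *ℕ q                             ≡⟨ ≡.cong (n ℕ.+_) (ℕₚ.*-comm n q) ⟩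
  suc q *ℕ n                               ∎))
  where
  open ℕₚ.≤-Reasoning
  q : ℕ
  q = toℕ (quotient {m} n r)

module Scalars {c ℓ} (𝕂 : ACF0 c ℓ) where
  open MatrixDefs 𝕂 public
  open ACF0 𝕂 using (char0)
  open IsCommutativeRing isCommutativeRing public hiding (zero)

  commutativeRing : CommutativeRing c ℓ
  commutativeRing = record { isCommutativeRing = isCommutativeRing }

  open CommutativeRing commutativeRing public
    using (ring; +-abelianGroup; +-commutativeSemigroup; *-commutativeSemigroup; _≉_)
  open import Algebra.Properties.Ring ring public using (-‿distribˡ-*; -‿distribʳ-*)
  open import Algebra.Properties.AbelianGroup +-abelianGroup public
    using () renaming (⁻¹-involutive to -‿involutive; ⁻¹-∙-comm to -‿+-comm; ε⁻¹≈ε to -0#≈0#)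
  module +S = Algebra.Properties.CommutativeSemigroup +-commutativeSemigroup
  open import Algebra.Properties.CommutativeSemigroup *-commutativeSemigroup public
  open import Relation.Binary.Reasoning.Setoid setoid

  ⁻¹-inverseˡ : ∀ {x} → x ≉ 0# → x ⁻¹ * x ≈ 1#
  ⁻¹-inverseˡ {x} x≉0 = trans (*-comm (x ⁻¹) x) (inverseʳ x x≉0)

  x*y≈1⇒x≉0 : ∀ {x y} → x * y ≈ 1# → x ≉ 0#
  x*y≈1⇒x≉0 {x} {y} xy≈1 x≈0 = 0≉1 (begin
    0#     ≈⟨ sym (zeroˡ y) ⟩
    0# * y ≈⟨ *-congʳ x≈0 ⟨
    x * y  ≈⟨ xy≈1 ⟩
    1#     ∎)

  x≈ay⇒y≈a⁻¹x : ∀ {a x y} → a ≉ 0# → x ≈ a * y → y ≈ a ⁻¹ * x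
  x≈ay⇒y≈a⁻¹x {a} {x} {y} a≉0 x≈ay = begin
    y              ≈⟨ *-identityˡ y ⟨
    1# * y         ≈⟨ *-congʳ (⁻¹-inverseˡ a≉0) ⟨
    (a ⁻¹ * a) * y ≈⟨ *-assoc _ _ _ ⟩
    a ⁻¹ * (a * y) ≈⟨ *-congˡ x≈ay ⟨
    a ⁻¹ * x       ∎

  *-cancelˡ : ∀ {a x y} → a ≉ 0# → a * x ≈ a * y → x ≈ y
  *-cancelˡ a≉0 ax≈ay =
    trans (x≈ay⇒y≈a⁻¹x a≉0 refl) (trans (*-congˡ ax≈ay) (sym (x≈ay⇒y≈a⁻¹x a≉0 refl)))

  ⁻¹-unique : ∀ {x y} → x * y ≈ 1# → y ≈ x ⁻¹
  ⁻¹-unique {x} xy≈1 = trans (x≈ay⇒y≈a⁻¹x (x*y≈1⇒x≉0 xy≈1) (sym xy≈1)) (*-identityʳ (x ⁻¹))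

  x+a+[-x+b]≈a+b : ∀ x a b → (x + a) + (- x + b) ≈ a + b
  x+a+[-x+b]≈a+b x a b = begin
    (x + a) + (- x + b)   ≈⟨ +S.interchange x a (- x) b ⟩
    (x + - x) + (a + b)   ≈⟨ +-congʳ (-‿inverseʳ x) ⟩
    0# + (a + b)          ≈⟨ +-identityˡ _ ⟩
    a + b                 ∎

  *-≉0 : ∀ {x y} → x ≉ 0# → y ≉ 0# → x * y ≉ 0#
  *-≉0 {x} {y} x≉0 y≉0 xy≈0 = y≉0 (*-cancelˡ x≉0 (trans xy≈0 (sym (zeroʳ x))))

  -‿≉0 : ∀ {x} → x ≉ 0# → - x ≉ 0#
  -‿≉0 {x} x≉0 -x≈0 = x≉0 (trans (sym (-‿involutive x)) (trans (-‿cong -x≈0) -0#≈0#))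

  ⁻¹-involutive : ∀ {x} → x ≉ 0# → x ⁻¹ ⁻¹ ≈ x
  ⁻¹-involutive x≉0 = sym (⁻¹-unique (⁻¹-inverseˡ x≉0))

  ⁻¹-distrib-* : ∀ {x y} → x ≉ 0# → y ≉ 0# → (x * y) ⁻¹ ≈ x ⁻¹ * y ⁻¹
  ⁻¹-distrib-* {x} {y} x≉0 y≉0 = sym (⁻¹-unique (begin
    (x * y) * (x ⁻¹ * y ⁻¹)     ≈⟨ interchange x y (x ⁻¹) (y ⁻¹) ⟩
    (x * x ⁻¹) * (y * y ⁻¹)     ≈⟨ *-cong (inverseʳ x x≉0) (inverseʳ y y≉0) ⟩
    1# * 1#                     ≈⟨ *-identityˡ 1# ⟩
    1#                          ∎))

  ⁻¹-‿ : ∀ {x} → x ≉ 0# → (- x) ⁻¹ ≈ - (x ⁻¹)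
  ⁻¹-‿ {x} x≉0 = sym (⁻¹-unique (begin
    (- x) * (- (x ⁻¹)) ≈⟨ -‿distribˡ-* x (- (x ⁻¹)) ⟨
    - (x * - (x ⁻¹))   ≈⟨ -‿cong (-‿distribʳ-* x (x ⁻¹)) ⟨
    - (- (x * x ⁻¹))   ≈⟨ -‿involutive _ ⟩
    x * x ⁻¹           ≈⟨ inverseʳ x x≉0 ⟩
    1#                 ∎))

  -- The index only witnesses n ≠ 0, so that characteristic 0 applies.
  square-root-≉0 : ∀ {n d} → Fin n → d * d ≈ fromℕ n → d ≉ 0#
  square-root-≉0 {suc n} {d} _ dd≈n d≈0 = char0 n (begin
    fromℕ (suc n)  ≈⟨ dd≈n ⟨
    d * d          ≈⟨ *-congʳ d≈0 ⟩
    0# * d         ≈⟨ zeroˡ d ⟩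
    0#             ∎)

  ∑-cong : ∀ {n} {f g : Vect n} → f ≈ᵥ g → sumF f ≈ sumF g
  ∑-cong {zero}  f≈g = refl
  ∑-cong {suc n} f≈g = +-cong (f≈g zero) (∑-cong (λ k → f≈g (suc k)))

  ∑-zero : ∀ n → sumF {n} (λ _ → 0#) ≈ 0#
  ∑-zero zero    = refl
  ∑-zero (suc n) = trans (+-identityˡ _) (∑-zero n)

  ∑-distrib-+ : ∀ {n} (f g : Vect n) → sumF (λ k → f k + g k) ≈ sumF f + sumF g
  ∑-distrib-+ {zero}  f g = sym (+-identityʳ 0#)
  ∑-distrib-+ {suc n} f g =
    trans (+-congˡ (∑-distrib-+ (λ k → f (suc k)) (λ k → g (suc k)))) (+S.interchange _ _ _ _)

  ∑-distrib-‿ : ∀ {n} (f : Vect n) → sumF (λ k → - f k) ≈ - sumF f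
  ∑-distrib-‿ {zero}  f = sym -0#≈0#
  ∑-distrib-‿ {suc n} f = trans (+-congˡ (∑-distrib-‿ (λ k → f (suc k)))) (-‿+-comm _ _)

  *-distribˡ-∑ : ∀ {n} a (f : Vect n) → a * sumF f ≈ sumF (λ k → a * f k)
  *-distribˡ-∑ {zero}  a f = zeroʳ a
  *-distribˡ-∑ {suc n} a f = trans (distribˡ a _ _) (+-congˡ (*-distribˡ-∑ a (λ k → f (suc k))))

  *-distribʳ-∑ : ∀ {n} a (f : Vect n) → sumF f * a ≈ sumF (λ k → f k * a)
  *-distribʳ-∑ {zero}  a f = zeroˡ a
  *-distribʳ-∑ {suc n} a f = trans (distribʳ a _ _) (+-congˡ (*-distribʳ-∑ a (λ k → f (suc k))))

  ∑-comm : ∀ {m n} (f : Fin m → Fin n → Carrier) →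
           sumF (λ i → sumF (f i)) ≈ sumF (λ j → sumF (λ i → f i j))
  ∑-comm {zero}  {n} f = sym (∑-zero n)
  ∑-comm {suc m} {n} f = begin
    sumF (f zero) + sumF (λ i → sumF (f (suc i)))           ≈⟨ +-congˡ (∑-comm (λ i → f (suc i))) ⟩
    sumF (f zero) + sumF (λ j → sumF (λ i → f (suc i) j))   ≈⟨ ∑-distrib-+ (f zero) _ ⟨
    sumF (λ j → f zero j + sumF (λ i → f (suc i) j))        ∎

  ∑-↑ : ∀ m {k} (f : Vect (m ℕ.+ k)) → sumF f ≈ sumF (λ i → f (i ↑ˡ k)) + sumF (λ j → f (m ↑ʳ j))
  ∑-↑ zero    f = sym (+-identityˡ _)
  ∑-↑ (suc m) f = trans (+-congˡ (∑-↑ m (λ x → f (suc x)))) (sym (+-assoc _ _ _))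

  ∑-combine : ∀ m {n} (f : Vect (m *ℕ n)) → sumF f ≈ sumF {m} (λ p → sumF {n} (λ k → f (combine p k)))
  ∑-combine zero    f = refl
  ∑-combine (suc m) {n} f = trans (∑-↑ n f) (+-congˡ (∑-combine m (λ j → f (n ↑ʳ j))))

  δ-refl : ∀ {n} (i : Fin n) → δ i i ≡.≡ 1#
  δ-refl zero    = ≡.refl
  δ-refl (suc i) = δ-refl i

  δ-sym : ∀ {n} (i j : Fin n) → δ i j ≡.≡ δ j i
  δ-sym zero    zero    = ≡.refl
  δ-sym zero    (suc j) = ≡.refl
  δ-sym (suc i) zero    = ≡.refl
  δ-sym (suc i) (suc j) = δ-sym i j

  δ-diagonal : ∀ {n} (f : Fin n → Fin n → Carrier) i j → f i j * δ i j ≈ f i i * δ i j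
  δ-diagonal f zero    zero    = refl
  δ-diagonal f zero    (suc j) = trans (zeroʳ _) (sym (zeroʳ _))
  δ-diagonal f (suc i) zero    = trans (zeroʳ _) (sym (zeroʳ _))
  δ-diagonal f (suc i) (suc j) = δ-diagonal (λ k l → f (suc k) (suc l)) i j

  ∑-δˡ : ∀ {n} i (f : Vect n) → sumF (λ k → δ i k * f k) ≈ f i
  ∑-δˡ {suc n} zero f = begin
    1# * f zero + sumF (λ k → 0# * f (suc k)) ≈⟨ +-cong (*-identityˡ _) (trans (∑-cong {n} (λ k → zeroˡ _)) (∑-zero n)) ⟩
    f zero + 0#                               ≈⟨ +-identityʳ _ ⟩
    f zero                                    ∎
  ∑-δˡ {suc n} (suc i) f = trans (+-cong (zeroˡ _) (∑-δˡ i (λ k → f (suc k)))) (+-identityˡ _)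

  ∑-δʳ : ∀ {n} i (f : Vect n) → sumF (λ k → f k * δ k i) ≈ f i
  ∑-δʳ i f = trans (∑-cong (λ k → trans (*-comm _ _) (*-congʳ (reflexive (δ-sym k i))))) (∑-δˡ i f)

module Matrices {c ℓ} (𝕂 : ACF0 c ℓ) where
  open Scalars 𝕂
  open import Relation.Binary.Reasoning.Setoid setoid

  ·-assoc : ∀ {n} (X Y Z : Mat n) → ((X · Y) · Z) ≈ₘ (X · (Y · Z))
  ·-assoc {n} X Y Z i j = begin
    sumF (λ k → sumF (λ l → X i l * Y l k) * Z k j)   ≈⟨ ∑-cong (λ k → *-distribʳ-∑ (Z k j) (λ l → X i l * Y l k)) ⟩
    sumF (λ k → sumF (λ l → (X i l * Y l k) * Z k j)) ≈⟨ ∑-comm (λ k l → (X i l * Y l k) * Z k j) ⟩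
    sumF (λ l → sumF (λ k → (X i l * Y l k) * Z k j)) ≈⟨ ∑-cong {n} (λ l → ∑-cong {n} (λ k → *-assoc _ _ _)) ⟩
    sumF (λ l → sumF (λ k → X i l * (Y l k * Z k j))) ≈⟨ ∑-cong (λ l → *-distribˡ-∑ (X i l) (λ k → Y l k * Z k j)) ⟨
    sumF (λ l → X i l * sumF (λ k → Y l k * Z k j))   ∎

  ·-congˡ : ∀ {n} (X : Mat n) {Y Y′ : Mat n} → Y ≈ₘ Y′ → (X · Y) ≈ₘ (X · Y′)
  ·-congˡ X Y≈Y′ i j = ∑-cong (λ k → *-congˡ (Y≈Y′ k j))

  ·-congʳ : ∀ {n} {X X′ : Mat n} (Y : Mat n) → X ≈ₘ X′ → (X · Y) ≈ₘ (X′ · Y)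
  ·-congʳ Y X≈X′ i j = ∑-cong (λ k → *-congʳ (X≈X′ i k))

  ·-identityˡ : ∀ {n} (X : Mat n) → (Id · X) ≈ₘ X
  ·-identityˡ X i j = ∑-δˡ i (λ k → X k j)

  ·-identityʳ : ∀ {n} (X : Mat n) → (X · Id) ≈ₘ X
  ·-identityʳ X i j = ∑-δʳ j (X i)

  ᵀ-· : ∀ {n} (X Y : Mat n) → ((X · Y) ᵀ) ≈ₘ ((Y ᵀ) · (X ᵀ))
  ᵀ-· {n} X Y i j = ∑-cong {n} (λ k → *-comm _ _)

  ᵀ-inverse : ∀ {n} {X Y : Mat n} → (X · Y) ≈ₘ Id → ((Y ᵀ) · (X ᵀ)) ≈ₘ Id
  ᵀ-inverse {X = X} {Y} XY≈Id i j = trans (sym (ᵀ-· X Y i j)) (trans (XY≈Id j i) (reflexive (δ-sym j i)))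

  ·-▹ : ∀ {n} (X Y : Mat n) (v : Vect n) → ((X · Y) ▹ v) ≈ᵥ (X ▹ (Y ▹ v))
  ·-▹ {n} X Y v i = begin
    sumF (λ k → sumF (λ l → X i l * Y l k) * v k)   ≈⟨ ∑-cong (λ k → *-distribʳ-∑ (v k) (λ l → X i l * Y l k)) ⟩
    sumF (λ k → sumF (λ l → (X i l * Y l k) * v k)) ≈⟨ ∑-comm (λ k l → (X i l * Y l k) * v k) ⟩
    sumF (λ l → sumF (λ k → (X i l * Y l k) * v k)) ≈⟨ ∑-cong {n} (λ l → ∑-cong {n} (λ k → *-assoc _ _ _)) ⟩
    sumF (λ l → sumF (λ k → X i l * (Y l k * v k))) ≈⟨ ∑-cong (λ l → *-distribˡ-∑ (X i l) (λ k → Y l k * v k)) ⟨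
    sumF (λ l → X i l * sumF (λ k → Y l k * v k))   ∎

  ▹-cong : ∀ {n} (X : Mat n) {u v : Vect n} → u ≈ᵥ v → (X ▹ u) ≈ᵥ (X ▹ v)
  ▹-cong X u≈v i = ∑-cong (λ k → *-congˡ (u≈v k))

  ▹-congˡ : ∀ {n} {X Y : Mat n} (v : Vect n) → X ≈ₘ Y → (X ▹ v) ≈ᵥ (Y ▹ v)
  ▹-congˡ v X≈Y i = ∑-cong (λ k → *-congʳ (X≈Y i k))

  ⊕-▹ : ∀ {n} (X Y : Mat n) (v : Vect n) i → ((X ⊕ Y) ▹ v) i ≈ (X ▹ v) i + (Y ▹ v) i
  ⊕-▹ {n} X Y v i = trans (∑-cong {n} (λ k → distribʳ (v k) _ _)) (∑-distrib-+ (λ k → X i k * v k) (λ k → Y i k * v k))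

  ⊖-▹ : ∀ {n} (X Y : Mat n) (v : Vect n) i → ((X ⊖ Y) ▹ v) i ≈ (X ▹ v) i + - (Y ▹ v) i
  ⊖-▹ X Y v i = begin
    sumF (λ k → (X i k + - Y i k) * v k)
      ≈⟨ ∑-cong (λ k → trans (distribʳ (v k) _ _) (+-congˡ (sym (-‿distribˡ-* _ _)))) ⟩
    sumF (λ k → X i k * v k + - (Y i k * v k))  ≈⟨ ∑-distrib-+ (λ k → X i k * v k) (λ k → - (Y i k * v k)) ⟩
    (X ▹ v) i + sumF (λ k → - (Y i k * v k))    ≈⟨ +-congˡ (∑-distrib-‿ (λ k → Y i k * v k)) ⟩
    (X ▹ v) i + - (Y ▹ v) i                     ∎

  -‿ᵥ : ∀ {n} → Vect n → Vect n
  -‿ᵥ v k = - v k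

  ▹-‿ : ∀ {n} (X : Mat n) (v : Vect n) i → (X ▹ -‿ᵥ v) i ≈ - (X ▹ v) i
  ▹-‿ {n} X v i = trans (∑-cong {n} (λ k → sym (-‿distribʳ-* _ _))) (∑-distrib-‿ (λ k → X i k * v k))

  ▹-⋆ᵥ : ∀ {n} (X : Mat n) a (v : Vect n) → (X ▹ (a ⋆ᵥ v)) ≈ᵥ (a ⋆ᵥ (X ▹ v))
  ▹-⋆ᵥ {n} X a v i = trans (∑-cong {n} (λ k → x∙yz≈y∙xz _ _ _)) (sym (*-distribˡ-∑ a (λ k → X i k * v k)))

  diag : ∀ {n} → Vect n → Mat n
  diag μ i j = δ i j * μ j

  ·-diag : ∀ {n} (X : Mat n) (μ : Vect n) i j → (X · diag μ) i j ≈ X i j * μ j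
  ·-diag {n} X μ i j = trans (∑-cong {n} (λ k → x∙yz≈xz∙y _ _ _)) (∑-δʳ j (λ k → X i k * μ j))

  ·-diagᵀ : ∀ {n} (X : Mat n) (μ : Vect n) i j → (X · (diag μ ᵀ)) i j ≈ X i j * μ j
  ·-diagᵀ {n} X μ i j = trans (∑-cong {n} (λ k → x∙yz≈y∙xz _ _ _)) (∑-δˡ j (λ k → X i k * μ k))

  eigenvector-resp : ∀ {n} (X : Mat n) {μ a} {u w : Vect n} →
                     (X ▹ w) ≈ᵥ (μ ⋆ᵥ w) → u ≈ᵥ (a ⋆ᵥ w) → (X ▹ u) ≈ᵥ (μ ⋆ᵥ u)
  eigenvector-resp X {μ} {a} {u} {w} Xw≈μw u≈aw i = begin
    (X ▹ u) i         ≈⟨ ▹-cong X u≈aw i ⟩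
    (X ▹ (a ⋆ᵥ w)) i  ≈⟨ ▹-⋆ᵥ X a w i ⟩
    a * (X ▹ w) i     ≈⟨ *-congˡ (Xw≈μw i) ⟩
    a * (μ * w i)     ≈⟨ x∙yz≈y∙xz a μ (w i) ⟩
    μ * (a * w i)     ≈⟨ *-congˡ (u≈aw i) ⟨
    μ * u i           ∎

module DualBasis {c ℓ} (𝕂 : ACF0 c ℓ) where
  open Scalars 𝕂
  open Matrices 𝕂

  matrixSetoid : ℕ → Setoid c ℓ
  matrixSetoid n = Pointwise.≋-setoid (Pointwise.≋-setoid setoid n) n

  ᵀ-conjugate : ∀ {n} (K X W D : Mat n) → ((K ᵀ) · X) ≈ₘ (X · D) →
                (W · (X ᵀ)) ≈ₘ Id → ((X ᵀ) · W) ≈ₘ Id → (K · W) ≈ₘ (W · (D ᵀ))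
  ᵀ-conjugate {n} K X W D KᵀX≈XD WXᵀ≈Id XᵀW≈Id = begin
    K · W                       ≈⟨ ·-identityˡ (K · W) ⟨
    Id · (K · W)                ≈⟨ ·-congʳ (K · W) WXᵀ≈Id ⟨
    (W · (X ᵀ)) · (K · W)       ≈⟨ ·-assoc W (X ᵀ) (K · W) ⟩
    W · ((X ᵀ) · (K · W))       ≈⟨ ·-congˡ W (·-assoc (X ᵀ) K W) ⟨
    W · (((X ᵀ) · K) · W)       ≈⟨ ·-congˡ W (·-congʳ W XᵀK≈DᵀXᵀ) ⟩
    W · (((D ᵀ) · (X ᵀ)) · W)   ≈⟨ ·-congˡ W (·-assoc (D ᵀ) (X ᵀ) W) ⟩
    W · ((D ᵀ) · ((X ᵀ) · W))   ≈⟨ ·-congˡ W (·-congˡ (D ᵀ) XᵀW≈Id) ⟩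
    W · ((D ᵀ) · Id)            ≈⟨ ·-congˡ W (·-identityʳ (D ᵀ)) ⟩
    W · (D ᵀ)                   ∎
    where
    open import Relation.Binary.Reasoning.Setoid (matrixSetoid n)
    XᵀK≈DᵀXᵀ : ((X ᵀ) · K) ≈ₘ ((D ᵀ) · (X ᵀ))
    XᵀK≈DᵀXᵀ = begin
      (X ᵀ) · K        ≈⟨ ᵀ-· (K ᵀ) X ⟨
      ((K ᵀ) · X) ᵀ    ≈⟨ (λ i j → KᵀX≈XD j i) ⟩
      (X · D) ᵀ        ≈⟨ ᵀ-· X D ⟩
      (D ᵀ) · (X ᵀ)    ∎

  transpose-eigenvectors : ∀ {n} (K X W : Mat n) (μ : Vect n) →
    (∀ b → ((K ᵀ) ▹ col X b) ≈ᵥ (μ b ⋆ᵥ col X b)) →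
    (W · (X ᵀ)) ≈ₘ Id → ((X ᵀ) · W) ≈ₘ Id →
    ∀ b → (K ▹ col W b) ≈ᵥ (μ b ⋆ᵥ col W b)
  transpose-eigenvectors K X W μ eigen WXᵀ≈Id XᵀW≈Id b m =
    trans (ᵀ-conjugate K X W (diag μ) KᵀX≈Xμ WXᵀ≈Id XᵀW≈Id m b)
          (trans (·-diagᵀ W μ m b) (*-comm _ _))
    where
    KᵀX≈Xμ : ((K ᵀ) · X) ≈ₘ (X · diag μ)
    KᵀX≈Xμ i j = trans (eigen j i) (trans (*-comm _ _) (sym (·-diag X μ i j)))

module JonesPairs {c ℓ} (𝕂 : ACF0 c ℓ) where
  open Scalars 𝕂
  open Matrices 𝕂
  open DualBasis 𝕂 using (transpose-eigenvectors)
  open import Relation.Binary.Reasoning.Setoid setoid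

  Δ-invertible⇒NoZeroEntry : ∀ {n} {B : Mat n} → InvertibleMap Δ[ B ] → NoZeroEntry B
  Δ-invertible⇒NoZeroEntry (_ , _ , Δ∘L≈id) a b = x*y≈1⇒x≉0 (Δ∘L≈id (λ _ _ → 1#) a b)

  braid⇒IsΘ : ∀ {n} {A C : Mat n} → NoZeroEntry C →
              (∀ M → X[ A ] (Δ[ C ] (X[ A ] M)) ≈ₘ Δ[ C ] (X[ A ] (Δ[ C ] M))) →
              IsΘ A C A C
  braid⇒IsΘ {n} {A} {C} C≉0 braid h c a = begin
    S                             ≈⟨ *-identityʳ S ⟨
    S * 1#                        ≈⟨ *-congˡ (⁻¹-inverseˡ (C≉0 h c)) ⟨
    S * (C h c ⁻¹ * C h c)        ≈⟨ *-assoc S _ _ ⟨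
    (S * C h c ⁻¹) * C h c        ≈⟨ *-congʳ braid-at-ac ⟩
    (C a c * A a h) * C h c       ≈⟨ xy∙z≈z∙yx _ _ _ ⟩
    C h c * (A a h * C a c)       ∎
    where
    S : Carrier
    S = sumF (λ k → A a k * (A k h * C k c))
    -- chosen so that every column of C ∘ₘ M is e_h
    M : Mat n
    M l c′ = C l c′ ⁻¹ * δ l h
    AM : ∀ k → (A · M) k c ≈ A k h * C h c ⁻¹
    AM k = trans (∑-cong {n} (λ l → x∙yz≈xy∙z _ _ _)) (∑-δʳ h (λ l → A k l * C l c ⁻¹))
    C∘M : ∀ k → (C ∘ₘ M) k c ≈ δ k h
    C∘M k = trans (x∙yz≈xy∙z _ _ _) (trans (*-congʳ (inverseʳ _ (C≉0 k c))) (*-identityˡ _))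
    braid-at-ac : S * C h c ⁻¹ ≈ C a c * A a h
    braid-at-ac = begin
      S * C h c ⁻¹                                     ≈⟨ *-distribʳ-∑ _ (λ k → A a k * (A k h * C k c)) ⟩
      sumF (λ k → (A a k * (A k h * C k c)) * C h c ⁻¹)
        ≈⟨ ∑-cong {n} (λ k → trans (*-assoc _ _ _) (*-congˡ (xy∙z≈y∙xz _ _ _))) ⟩
      sumF (λ k → A a k * (C k c * (A k h * C h c ⁻¹))) ≈⟨ ∑-cong {n} (λ k → *-congˡ (*-congˡ (AM k))) ⟨
      X[ A ] (Δ[ C ] (X[ A ] M)) a c                    ≈⟨ braid M a c ⟩
      C a c * sumF (λ k → A a k * (C ∘ₘ M) k c)         ≈⟨ *-congˡ (∑-cong {n} (λ k → *-congˡ (C∘M k))) ⟩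
      C a c * sumF (λ k → A a k * δ k h)                ≈⟨ *-congˡ (∑-δʳ h (A a)) ⟩
      C a c * A a h                                     ∎

  IsΘ⇒C∘Yᵀ-factorises : ∀ {n} {A C Y : Mat n} → NoZeroEntry A → (Y · C) ≈ₘ Id → (C · Y) ≈ₘ Id →
                         IsΘ A C A C → ∀ h j → C h j * Y j h ≈ A h h * sumF (Y j)
  IsΘ⇒C∘Yᵀ-factorises {n} {A} {C} {Y} A≉0 YC≈Id CY≈Id ΘA h j = begin
    C h j * Y j h                   ≈⟨ ∑-δˡ j u ⟨
    sumF (λ l → δ j l * u l)        ≈⟨ ∑-cong {n} (λ l → *-congʳ (YC≈Id j l)) ⟨
    ((Y · C) ▹ u) j                 ≈⟨ ·-▹ Y C u j ⟩
    sumF (λ a → Y j a * (C ▹ u) a)  ≈⟨ ∑-cong {n} (λ a → *-congˡ (diagonal-entry a)) ⟨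
    sumF (λ a → Y j a * A h h)      ≈⟨ *-distribʳ-∑ (A h h) (Y j) ⟨
    sumF (Y j) * A h h              ≈⟨ *-comm _ _ ⟩
    A h h * sumF (Y j)              ∎
    where
    u : Vect n
    u l = C h l * Y l h
    P : Mat n
    P a k = A a k * A k h
    regroup : ∀ x y z w → (x * (y * z)) * w ≈ y * (z * (x * w))
    regroup x y z w = begin
      (x * (y * z)) * w   ≈⟨ trans (*-assoc _ _ _) (*-congˡ (*-assoc _ _ _)) ⟩
      x * (y * (z * w))   ≈⟨ x∙yz≈y∙xz _ _ _ ⟩
      y * (x * (z * w))   ≈⟨ *-congˡ (x∙yz≈y∙xz _ _ _) ⟩
      y * (z * (x * w))   ∎
    diagonal-entry : ∀ a → A h h ≈ (C ▹ u) a
    diagonal-entry a = *-cancelˡ (A≉0 a h) (begin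
      A a h * A h h                                   ≈⟨ ·-identityʳ P a h ⟨
      (P · Id) a h                                    ≈⟨ ·-congˡ P CY≈Id a h ⟨
      (P · (C · Y)) a h                               ≈⟨ ·-assoc P C Y a h ⟨
      ((P · C) · Y) a h
        ≈⟨ ∑-cong {n} (λ c → *-congʳ (trans (∑-cong {n} (λ k → *-assoc _ _ _)) (ΘA h c a))) ⟩
      sumF (λ c → (C h c * (A a h * C a c)) * Y c h)  ≈⟨ ∑-cong {n} (λ c → regroup _ _ _ _) ⟩
      sumF (λ c → A a h * (C a c * (C h c * Y c h)))  ≈⟨ *-distribˡ-∑ (A a h) (λ c → C a c * u c) ⟨
      A a h * (C ▹ u) a                               ∎)

  module InvertibleJonesPair {n} {A B Y : Mat n} (A≉0 : NoZeroEntry A) (B≉0 : NoZeroEntry B)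
    (YB≈Id : (Y · B) ≈ₘ Id) (BY≈Id : (B · Y) ≈ₘ Id)
    (braid  : ∀ M → X[ A ] (Δ[ B ] (X[ A ] M)) ≈ₘ Δ[ B ] (X[ A ] (Δ[ B ] M)))
    (braidᵀ : ∀ M → X[ A ] (Δ[ B ᵀ ] (X[ A ] M)) ≈ₘ Δ[ B ᵀ ] (X[ A ] (Δ[ B ᵀ ] M))) where

    B∘Yᵀ-factorises : ∀ h j → B h j * Y j h ≈ A h h * sumF (Y j)
    B∘Yᵀ-factorises = IsΘ⇒C∘Yᵀ-factorises A≉0 YB≈Id BY≈Id (braid⇒IsΘ B≉0 braid)

    Bᵀ∘Y-factorises : ∀ h j → B j h * Y h j ≈ A h h * sumF (λ a → Y a j)
    Bᵀ∘Y-factorises =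
      IsΘ⇒C∘Yᵀ-factorises A≉0 (ᵀ-inverse BY≈Id) (ᵀ-inverse YB≈Id) (braid⇒IsΘ (λ i j → B≉0 j i) braidᵀ)

    A-diagonal-constant : ∀ h h′ → A h h ≈ A h′ h′
    A-diagonal-constant h h′ = *-cancelˡ (x*y≈1⇒x≉0 (S*Aₕₕ≈1 h)) (trans (S*Aₕₕ≈1 h) (sym (S*Aₕₕ≈1 h′)))
      where
      S : Carrier
      S = sumF (λ j → sumF (Y j))
      S*Aₕₕ≈1 : ∀ h → S * A h h ≈ 1#
      S*Aₕₕ≈1 h = begin
        S * A h h                        ≈⟨ *-distribʳ-∑ (A h h) (λ j → sumF (Y j)) ⟩
        sumF (λ j → sumF (Y j) * A h h)  ≈⟨ ∑-cong {n} (λ j → trans (B∘Yᵀ-factorises h j) (*-comm _ _)) ⟨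
        (B · Y) h h                      ≈⟨ BY≈Id h h ⟩
        δ h h                            ≡⟨ δ-refl h ⟩
        1#                               ∎

    inverse-column : ∀ i → Σ[ κ ∈ Carrier ] κ ≉ 0# × (col Y i ≈ᵥ (κ ⋆ᵥ col (schurInv B ᵀ) i))
    inverse-column i = κ , κ≉0 , Yki≈κ/Bik
      where
      κ : Carrier
      κ = A i i * sumF (λ a → Y a i)
      BY≈κ : ∀ k → B i k * Y k i ≈ κ
      BY≈κ k = trans (Bᵀ∘Y-factorises k i) (*-congʳ (A-diagonal-constant k i))
      κ≉0 : κ ≉ 0#
      κ≉0 κ≈0 = 0≉1 (begin
        0#                              ≈⟨ ∑-zero n ⟨
        sumF {n} (λ _ → 0#)             ≈⟨ ∑-cong {n} (λ k → trans (BY≈κ k) κ≈0) ⟨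
        (B · Y) i i                     ≈⟨ BY≈Id i i ⟩
        δ i i                           ≡⟨ δ-refl i ⟩
        1#                              ∎)
      Yki≈κ/Bik : col Y i ≈ᵥ (κ ⋆ᵥ col (schurInv B ᵀ) i)
      Yki≈κ/Bik k = trans (x≈ay⇒y≈a⁻¹x (B≉0 i k) (sym (BY≈κ k))) (*-comm _ _)

    paired-eigenvector : ∀ {K TK} → IsΘ A (B ᵀ) (K ᵀ) TK → ∀ i j →
      (K ▹ (col (schurInv B ᵀ) i ∘ᵥ col (schurInv A) j)) ≈ᵥ
      (TK j i ⋆ᵥ (col (schurInv B ᵀ) i ∘ᵥ col (schurInv A) j))
    paired-eigenvector {K} {TK} ΘKᵀ i j with inverse-column i
    ... | κ , κ≉0 , Y≈κB⁻ =
      eigenvector-resp K (transpose-eigenvectors K X W (TK j) (ΘKᵀ j) WXᵀ≈Id XᵀW≈Id i)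
        (λ k → x≈ay⇒y≈a⁻¹x κ≉0 (trans (*-congˡ (Y≈κB⁻ k)) (x∙yz≈y∙zx _ _ _)))
      where
      X W : Mat n
      X k b = A k j * B b k
      W k b = A k j ⁻¹ * Y k b
      WXᵀ≈Id : (W · (X ᵀ)) ≈ₘ Id
      WXᵀ≈Id m m′ = begin
        sumF (λ b → (A m j ⁻¹ * Y m b) * (A m′ j * B b m′))  ≈⟨ ∑-cong {n} (λ b → interchange _ _ _ _) ⟩
        sumF (λ b → (A m j ⁻¹ * A m′ j) * (Y m b * B b m′))  ≈⟨ *-distribˡ-∑ _ (λ b → Y m b * B b m′) ⟨
        (A m j ⁻¹ * A m′ j) * (Y · B) m m′                    ≈⟨ *-congˡ (YB≈Id m m′) ⟩
        (A m j ⁻¹ * A m′ j) * δ m m′                          ≈⟨ δ-diagonal (λ x y → A x j ⁻¹ * A y j) m m′ ⟩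
        (A m j ⁻¹ * A m j) * δ m m′                           ≈⟨ *-congʳ (⁻¹-inverseˡ (A≉0 m j)) ⟩
        1# * δ m m′                                           ≈⟨ *-identityˡ _ ⟩
        δ m m′                                                ∎
      XᵀW≈Id : ((X ᵀ) · W) ≈ₘ Id
      XᵀW≈Id b b′ = begin
        sumF (λ k → (A k j * B b k) * (A k j ⁻¹ * Y k b′))   ≈⟨ ∑-cong {n} (λ k → interchange _ _ _ _) ⟩
        sumF (λ k → (A k j * A k j ⁻¹) * (B b k * Y k b′))
          ≈⟨ ∑-cong {n} (λ k → trans (*-congʳ (inverseʳ _ (A≉0 k j))) (*-identityˡ _)) ⟩
        (B · Y) b b′                                          ≈⟨ BY≈Id b b′ ⟩
        δ b b′                                                ∎

module BlockMatrices {c ℓ} (𝕂 : ACF0 c ℓ) where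
  open Scalars 𝕂
  open Matrices 𝕂
  open import Relation.Binary.Reasoning.Setoid setoid

  ≈ᵥ-by-blocks : ∀ {m n} {u v : Vect (m *ℕ n)} → (∀ p i → u (combine p i) ≈ v (combine p i)) → u ≈ᵥ v
  ≈ᵥ-by-blocks {m} {n} {u} {v} u≈v a =
    ≡.subst (λ a → u a ≈ v a) (Finₚ.combine-remQuot {m} n a) (u≈v (quotient {m} n a) (remainder {m} n a))

  block4-row : ∀ {n} (X : Fin 4 → Fin 4 → Mat n) p i b →
               block4 X (combine p i) b ≡.≡ X p (quotient n b) i (remainder {4} n b)
  block4-row {n} X p i b =
    ≡.cong (λ pi → X (proj₁ pi) (quotient n b) (proj₂ pi) (remainder {4} n b)) (Finₚ.remQuot-combine p i)

  block4-entry : ∀ {n} (X : Fin 4 → Fin 4 → Mat n) p i q k → block4 X (combine p i) (combine q k) ≡.≡ X p q i k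
  block4-entry X p i q k =
    ≡.trans (block4-row X p i (combine q k)) (≡.cong (λ qk → X p (proj₁ qk) i (proj₂ qk)) (Finₚ.remQuot-combine q k))

  record SignedBlocks {n} (v : Vect (4 *ℕ n)) (x y : Vect n) : Set ℓ where
    field
      block₀ : ∀ k → v (combine {4} 0F k) ≈ x k
      block₁ : ∀ k → v (combine {4} 1F k) ≈ - x k
      block₂ : ∀ k → v (combine {4} 2F k) ≈ y k
      block₃ : ∀ k → v (combine {4} 3F k) ≈ - y k

  block4-▹-signed : ∀ {n} (X : Fin 4 → Fin 4 → Mat n) {v x y} → SignedBlocks v x y → ∀ p i →
    (block4 X ▹ v) (combine p i) ≈
    ((X p 0F ▹ x) i + (X p 1F ▹ -‿ᵥ x) i) + ((X p 2F ▹ y) i + (X p 3F ▹ -‿ᵥ y) i)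
  block4-▹-signed {n} X {v} {x} {y} v≈ p i = begin
    (block4 X ▹ v) (combine p i)
      ≈⟨ ∑-combine 4 {n} (λ b → block4 X (combine p i) b * v b) ⟩
    sumF {4} (λ q → sumF {n} (λ k → block4 X (combine p i) (combine q k) * v (combine q k)))
      ≈⟨ ∑-cong {4} (λ q → ∑-cong {n} (λ k → *-congʳ {v (combine q k)} (reflexive (block4-entry X p i q k)))) ⟩
    sumF {4} (λ q → (X p q ▹ (λ k → v (combine q k))) i)
      ≈⟨ +-congˡ (+-congˡ (+-congˡ (+-identityʳ _))) ⟩
    t 0F + (t 1F + (t 2F + t 3F))
      ≈⟨ +-assoc (t 0F) (t 1F) _ ⟨
    (t 0F + t 1F) + (t 2F + t 3F)
      ≈⟨ +-cong (+-cong (▹-cong (X p 0F) block₀ i) (▹-cong (X p 1F) block₁ i))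
                (+-cong (▹-cong (X p 2F) block₂ i) (▹-cong (X p 3F) block₃ i)) ⟩
    ((X p 0F ▹ x) i + (X p 1F ▹ -‿ᵥ x) i) + ((X p 2F ▹ y) i + (X p 3F ▹ -‿ᵥ y) i) ∎
    where
    open SignedBlocks v≈
    t : Fin 4 → Carrier
    t q = (X p q ▹ (λ k → v (combine q k))) i

  SignedBlocks-≉0 : ∀ {n} {v : Vect (4 *ℕ n)} {x y} → SignedBlocks v x y → ∀ i → x i ≉ 0# → ¬ (∀ a → v a ≈ 0#)
  SignedBlocks-≉0 {n} v≈ i xi≉0 v≈0 = xi≉0 (trans (sym (SignedBlocks.block₀ v≈ i)) (v≈0 (combine {4} {n} 0F i)))

  ⊕⊖-alternating : ∀ {n} (P H : Mat n) (x : Vect n) i →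
    ((P ⊕ H) ▹ x) i + ((P ⊖ H) ▹ -‿ᵥ x) i ≈ (H ▹ x) i + (H ▹ x) i
  ⊕⊖-alternating P H x i = begin
    ((P ⊕ H) ▹ x) i + ((P ⊖ H) ▹ -‿ᵥ x) i
      ≈⟨ +-cong (⊕-▹ P H x i) (trans (▹-‿ (P ⊖ H) x i) (-‿cong (⊖-▹ P H x i))) ⟩
    (p + h) + - (p + - h)                 ≈⟨ +-congˡ (-‿+-comm p (- h)) ⟨
    (p + h) + (- p + - - h)               ≈⟨ +-congˡ (+-congˡ (-‿involutive h)) ⟩
    (p + h) + (- p + h)                   ≈⟨ x+a+[-x+b]≈a+b p h h ⟩
    h + h                                 ∎
    where
    p h : Carrier
    p = (P ▹ x) i
    h = (H ▹ x) i

  ⊖⊕-alternating : ∀ {n} (P H : Mat n) (x : Vect n) i →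
    ((P ⊖ H) ▹ x) i + ((P ⊕ H) ▹ -‿ᵥ x) i ≈ - (H ▹ x) i + - (H ▹ x) i
  ⊖⊕-alternating P H x i = begin
    ((P ⊖ H) ▹ x) i + ((P ⊕ H) ▹ -‿ᵥ x) i
      ≈⟨ +-cong (⊖-▹ P H x i) (trans (▹-‿ (P ⊕ H) x i) (-‿cong (⊕-▹ P H x i))) ⟩
    (p + - h) + - (p + h)                 ≈⟨ +-congˡ (-‿+-comm p h) ⟨
    (p + - h) + (- p + - h)               ≈⟨ x+a+[-x+b]≈a+b p (- h) (- h) ⟩
    - h + - h                             ∎
    where
    p h : Carrier
    p = (P ▹ x) i
    h = (H ▹ x) i

  alternating-cancel : ∀ {n} (G : Mat n) (y : Vect n) i → (G ▹ y) i + (G ▹ -‿ᵥ y) i ≈ 0#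
  alternating-cancel G y i = trans (+-congˡ (▹-‿ G y i)) (-‿inverseʳ _)

  𝓜-eigenvector : ∀ {n} (ΘAF ΘBF ΘG ΘGT H K : Mat n) {v x y μ} → SignedBlocks v x y →
    (H ▹ x) ≈ᵥ (μ ⋆ᵥ x) → (K ▹ y) ≈ᵥ (μ ⋆ᵥ y) →
    (block4 (Mblocks ΘAF ΘBF ΘG ΘGT H K) ▹ v) ≈ᵥ ((μ + μ) ⋆ᵥ v)
  𝓜-eigenvector ΘAF ΘBF ΘG ΘGT H K {v} {x} {y} {μ} v≈ Hx≈μx Ky≈μy = ≈ᵥ-by-blocks {4} row
    where
    open SignedBlocks v≈
    𝓜 : Fin 4 → Fin 4 → Mat _
    𝓜 = Mblocks ΘAF ΘBF ΘG ΘGT H K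
    doubled : ∀ {h w} → h ≈ μ * w → h + h ≈ (μ + μ) * w
    doubled {w = w} h≈μw = trans (+-cong h≈μw h≈μw) (sym (distribʳ w μ μ))
    negated : ∀ {h z w} → h ≈ μ * z → w ≈ - z → - h ≈ μ * w
    negated h≈μz w≈-z = trans (-‿cong h≈μz) (trans (-‿distribʳ-* μ _) (*-congˡ (sym w≈-z)))
    row : ∀ (p : Fin 4) i → (block4 𝓜 ▹ v) (combine p i) ≈ (μ + μ) * v (combine p i)
    row 0F i = trans (block4-▹-signed 𝓜 v≈ 0F i)
      (trans (+-cong (⊕⊖-alternating ΘAF H x i) (alternating-cancel ΘG y i))
      (trans (+-identityʳ _) (doubled (trans (Hx≈μx i) (*-congˡ (sym (block₀ i)))))))
    row 1F i = trans (block4-▹-signed 𝓜 v≈ 1F i)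
      (trans (+-cong (⊖⊕-alternating ΘAF H x i) (alternating-cancel ΘG y i))
      (trans (+-identityʳ _) (doubled (negated (Hx≈μx i) (block₁ i)))))
    row 2F i = trans (block4-▹-signed 𝓜 v≈ 2F i)
      (trans (+-cong (alternating-cancel (ΘGT ᵀ) x i) (⊕⊖-alternating ΘBF K y i))
      (trans (+-identityˡ _) (doubled (trans (Ky≈μy i) (*-congˡ (sym (block₂ i)))))))
    row 3F i = trans (block4-▹-signed 𝓜 v≈ 3F i)
      (trans (+-cong (alternating-cancel (ΘGT ᵀ) x i) (⊖⊕-alternating ΘBF K y i))
      (trans (+-identityˡ _) (doubled (negated (Ky≈μy i) (block₃ i)))))

module ColumnsOfV {c ℓ} (𝕂 : ACF0 c ℓ) where
  open Scalars 𝕂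
  open BlockMatrices 𝕂 using (SignedBlocks; block4-row)

  module _ {n} (d : Carrier) (A B : Mat n) where

    record LeftColumn (p : Fin 4) : Set (c ⊔ ℓ) where
      field
        scale   : Carrier
        scale≉0 : scale ≉ 0#
        block₀ : ∀ k i → Vblocks d A B 0F p k i ≈ scale * A k i
        block₁ : ∀ k i → Vblocks d A B 1F p k i ≈ - (scale * A k i)
        block₂ : ∀ k i → Vblocks d A B 2F p k i ≈ B i k ⁻¹
        block₃ : ∀ k i → Vblocks d A B 3F p k i ≈ B i k ⁻¹

    record RightColumn (p : Fin 4) : Set (c ⊔ ℓ) where
      field
        scale   : Carrier
        scale≉0 : scale ≉ 0#
        block₀ : ∀ k j → Vblocks d A B 0F p k j ≈ B k j ⁻¹
        block₁ : ∀ k j → Vblocks d A B 1F p k j ≈ B k j ⁻¹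
        block₂ : ∀ k j → Vblocks d A B 2F p k j ≈ scale * A k j
        block₃ : ∀ k j → Vblocks d A B 3F p k j ≈ - (scale * A k j)

    left-column : d ≉ 0# → ∀ p → toℕ p < 2 → LeftColumn p
    left-column d≉0 0F _ = record
      { scale = d ; scale≉0 = d≉0
      ; block₀ = λ _ _ → refl ; block₁ = λ _ _ → refl ; block₂ = λ _ _ → refl ; block₃ = λ _ _ → refl }
    left-column d≉0 1F _ = record
      { scale = - d ; scale≉0 = -‿≉0 d≉0
      ; block₀ = λ _ _ → -‿distribˡ-* _ _
      ; block₁ = λ _ _ → trans (sym (-‿involutive _)) (-‿cong (-‿distribˡ-* _ _))
      ; block₂ = λ _ _ → refl ; block₃ = λ _ _ → refl }
    left-column _ (suc (suc _)) (s≤s (s≤s ()))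

    right-column : d ≉ 0# → ∀ p → 2 ≤ toℕ p → RightColumn p
    right-column _ 0F ()
    right-column _ 1F (s≤s ())
    right-column d≉0 2F _ = record
      { scale = d ; scale≉0 = d≉0
      ; block₀ = λ _ _ → refl ; block₁ = λ _ _ → refl ; block₂ = λ _ _ → refl ; block₃ = λ _ _ → refl }
    right-column d≉0 3F _ = record
      { scale = - d ; scale≉0 = -‿≉0 d≉0
      ; block₀ = λ _ _ → refl ; block₁ = λ _ _ → refl
      ; block₂ = λ _ _ → -‿distribˡ-* _ _
      ; block₃ = λ _ _ → trans (sym (-‿involutive _)) (-‿cong (-‿distribˡ-* _ _)) }
    right-column _ (suc (suc (suc (suc ())))) _

    column-product-blocks : NoZeroEntry A → NoZeroEntry B → ∀ (r s : Fin (4 *ℕ n)) →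
      (L : LeftColumn (quotient n r)) (R : RightColumn (quotient n s)) →
      let i = remainder {4} n r
          j = remainder {4} n s
      in SignedBlocks (col (Vmat d A B) r ∘ᵥ col (schurInv (Vmat d A B)) s)
           (LeftColumn.scale L ⋆ᵥ (col A i ∘ᵥ col B j))
           ((RightColumn.scale R ⁻¹) ⋆ᵥ (col (schurInv B ᵀ) i ∘ᵥ col (schurInv A) j))
    column-product-blocks A≉0 B≉0 r s L R = record
      { block₀ = λ k → trans (reflexive (entry 0F k))
          (trans (*-cong (L.block₀ k i) (B⁻¹⁻¹ (R.block₀ k j))) (*-assoc _ _ _))
      ; block₁ = λ k → trans (reflexive (entry 1F k))
          (trans (*-cong (L.block₁ k i) (B⁻¹⁻¹ (R.block₁ k j)))
                 (trans (sym (-‿distribˡ-* _ _)) (-‿cong (*-assoc _ _ _))))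
      ; block₂ = λ k → trans (reflexive (entry 2F k))
          (trans (*-cong (L.block₂ k i) (trans (⁻¹-cong (R.block₂ k j)) (βA⁻¹ k)))
                 (x∙yz≈y∙xz _ _ _))
      ; block₃ = λ k → trans (reflexive (entry 3F k))
          (trans (*-cong (L.block₃ k i)
                         (trans (⁻¹-cong (R.block₃ k j)) (trans (⁻¹-‿ (*-≉0 R.scale≉0 (A≉0 k j))) (-‿cong (βA⁻¹ k)))))
                 (trans (sym (-‿distribʳ-* _ _)) (-‿cong (x∙yz≈y∙xz _ _ _))))
      }
      where
      module L = LeftColumn L
      module R = RightColumn R
      i j : Fin n
      i = remainder {4} n r
      j = remainder {4} n s
      entry : ∀ q k → (col (Vmat d A B) r ∘ᵥ col (schurInv (Vmat d A B)) s) (combine q k) ≡.≡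
                      Vblocks d A B q (quotient n r) k i * Vblocks d A B q (quotient n s) k j ⁻¹
      entry q k = ≡.cong₂ (λ a b → a * b ⁻¹) (block4-row (Vblocks d A B) q k r) (block4-row (Vblocks d A B) q k s)
      B⁻¹⁻¹ : ∀ {k u} → u ≈ B k j ⁻¹ → u ⁻¹ ≈ B k j
      B⁻¹⁻¹ {k} u≈B⁻¹ = trans (⁻¹-cong u≈B⁻¹) (⁻¹-involutive (B≉0 k j))
      βA⁻¹ : ∀ k → (R.scale * A k j) ⁻¹ ≈ R.scale ⁻¹ * A k j ⁻¹
      βA⁻¹ k = ⁻¹-distrib-* R.scale≉0 (A≉0 k j)

lemma7p4 : ∀ {c ℓ} (𝕂 : ACF0 c ℓ) → let open MatrixDefs 𝕂 in
    ∀ (n : ℕ) (A B : Mat n) (d : Carrier) →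
    IsInvertibleJonesPair A B → Symmetric A → (d * d) ≈ fromℕ n →
    ∀ (M : Mat (4 *ℕ n)) → In𝓑 A B M →
    ∀ (r s : Fin (4 *ℕ n)) → toℕ r < 2 *ℕ n → 2 *ℕ n ≤ toℕ s →
    IsEigenvector M (col (Vmat d A B) r ∘ᵥ col (schurInv (Vmat d A B)) s)
lemma7p4 𝕂 n A B d ((_ , Δ[B]-invertible , braid , braidᵀ) , A≉0 , (Y , YB≈Id , BY≈Id)) _ dd≈n M
         (_ , _ , H , K , ΘAF , ΘBF , ΘG , ΘGT , _ , _ , _ , (_ , TH , TK , ΘH , ΘKᵀ , TH≈TKᵀ) , _ , _ , _ , _ , M≈𝓜)
         r s r<2n 2n≤s =
  SignedBlocks-≉0 v-blocks i (*-≉0 (LeftColumn.scale≉0 L) (*-≉0 (A≉0 i i) (B≉0 i j))) ,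
  (TH i j + TH i j) ,
  λ a → trans (▹-congˡ v M≈𝓜 a) (𝓜-eigenvector ΘAF ΘBF ΘG ΘGT H K v-blocks Hx≈THx Ky≈THy a)
  where
  open Scalars 𝕂
  open Matrices 𝕂
  open JonesPairs 𝕂
  open BlockMatrices 𝕂
  open ColumnsOfV 𝕂
  B≉0 : NoZeroEntry B
  B≉0 = Δ-invertible⇒NoZeroEntry Δ[B]-invertible
  open InvertibleJonesPair A≉0 B≉0 YB≈Id BY≈Id braid braidᵀ
  i j : Fin n
  i = remainder {4} n r
  j = remainder {4} n s
  d≉0 : d ≉ 0#
  d≉0 = square-root-≉0 i dd≈n
  L : LeftColumn d A B (quotient n r)
  L = left-column d A B d≉0 (quotient n r) (quotient-< n r r<2n)
  R : RightColumn d A B (quotient n s)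
  R = right-column d A B d≉0 (quotient n s) (quotient-≥ n s 2n≤s)
  x y : Vect n
  v : Vect (4 *ℕ n)
  x = LeftColumn.scale L ⋆ᵥ (col A i ∘ᵥ col B j)
  y = (RightColumn.scale R ⁻¹) ⋆ᵥ (col (schurInv B ᵀ) i ∘ᵥ col (schurInv A) j)
  v = col (Vmat d A B) r ∘ᵥ col (schurInv (Vmat d A B)) s
  v-blocks : SignedBlocks v x y
  v-blocks = column-product-blocks d A B A≉0 B≉0 r s L R
  Hx≈THx : (H ▹ x) ≈ᵥ (TH i j ⋆ᵥ x)
  Hx≈THx = eigenvector-resp H (ΘH i j) (λ _ → refl)
  Ky≈THy : (K ▹ y) ≈ᵥ (TH i j ⋆ᵥ y)
  Ky≈THy = eigenvector-resp K (λ m → trans (paired-eigenvector ΘKᵀ i j m) (*-congʳ (sym (TH≈TKᵀ i j)))) (λ _ → refl)
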